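{- Let $m$, $k$ and $t$ be positive integers and set $n=m+k-1$. Then there exists a function $f$ from the set of $k$-subsets of $[n]$ to the set of $k$-multisets of $[m]$ such that: (1) $f$ is a bijection; (2) for every $k$-subset $A$ of $[n]$, the support of $f(A)$ equals $A \cap [m]$; (3) $f$ is a graph homomorphism from $K(n,k,t)$ to $M'(m,k,t)$.
   Context: A $k$-multiset of $[m]$ is a multiset of cardinality $k$ (counting repetitions) with elements from $[m]$; its support is the set of its distinct elements. The intersection of multisets $A,B$ is the multiset whose multiplicity of each $i$ is the minimum of the multiplicities in $A$ and $B$; sets are multisets with all multiplicities one. $K(n,k,t)$ is the graph whose vertices are the $k$-subsets of $[n]$, with $A,B$ adjacent iff $|A\cap B| < t$. $M'(m,k,t)$ is the graph whose vertices are the $k$-multisets of $[m]$, with $A,B$ adjacent iff $|A \cap B \cap [m]| < t$, i.e. iff their supports have fewer than $t$ common elements. A graph homomorphism maps adjacent vertices to adjacent vertices. -}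

module Defs where

open import Data.Nat using (ℕ; zero; suc; _+_; _∸_; _<_; _⊓_)
open import Data.Bool using (Bool; true; false)
open import Data.Vec using (Vec; map; zipWith; take; sum; replicate)
open import Data.Fin.Subset using (Subset; _∩_; ∣_∣)
open import Data.Product using (Σ; proj₁)
open import Relation.Binary.PropositionalEquality using (_≡_)

KSubset : ℕ → ℕ → Set
KSubset n k = Σ (Subset n) (λ A → ∣ A ∣ ≡ k)

Multiset : ℕ → Set
Multiset m = Vec ℕ m

msCard : ∀ {m} → Multiset m → ℕ
msCard = sum

KMultiset : ℕ → ℕ → Set
KMultiset m k = Σ (Multiset m) (λ μ → msCard μ ≡ k)

_∩ₘ_ : ∀ {m} → Multiset m → Multiset m → Multiset m
_∩ₘ_ = zipWith _⊓_

fullSetₘ : ∀ m → Multiset m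
fullSetₘ m = replicate m 1

positive : ℕ → Bool
positive zero = false
positive (suc _) = true

support : ∀ {m} → Multiset m → Subset m
support = map positive

restrict : ∀ m {j} → Subset (m + j) → Subset m
restrict m A = take m A

KAdj : ∀ n k t → KSubset n k → KSubset n k → Set
KAdj n k t A B = ∣ proj₁ A ∩ proj₁ B ∣ < t

MAdj : ∀ m k t → KMultiset m k → KMultiset m k → Set
MAdj m k t A B = msCard ((proj₁ A ∩ₘ proj₁ B) ∩ₘ fullSetₘ m) < t

-- Stars and bars. Write A ⊆ [m + k - 1] as S ++ w with S = A ∩ [m] and w a word of
-- length k - 1 in stars (true) and bars (false). Since |S| + #stars(w) = k and
-- #stars(w) + #bars(w) = k - 1, the word bar ∷ w has exactly |S| bars, so it cuts into
-- |S| blocks, each a bar followed by stars; giving the i-th element of S multiplicity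
-- 1 + (stars of the i-th block) yields a k-multiset with support S, and every such
-- multiset arises exactly once.
-- Multiplicities are positive precisely on S, so the multiset intersection meets [m]
-- in |S_A ∩ S_B| ≤ |A ∩ B| elements, and non-adjacency cannot be created.
module Submission where

open import Defs
open import Data.Nat using (ℕ; zero; suc; _+_; _∸_; _≤_; _⊓_)
open import Data.Nat.Properties
  using (+-suc; +-comm; suc-injective; ⊓-zeroʳ; ≡-irrelevant; +-cancelʳ-≡; m≤m+n)
open import Data.Bool using (Bool; true; false)
open import Data.List as List using (List)
open import Data.Vec using (Vec; []; _∷_; _++_; take; drop; tail; replicate; cast; toList)
open import Data.Vec.Properties
  using (take++drop≡id; take-zipWith; ++-injective; toList-++; toList-replicate;
         toList-injective; length-toList)
open import Data.Vec.Relation.Binary.Equality.Cast using (cast-is-id)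
open import Data.Fin.Subset using (Subset; _∩_; ∁; ∣_∣)
open import Data.Product using (Σ; _×_; _,_; proj₁; proj₂)
open import Data.Product.Properties using (Σ-≡,≡→≡)
open import Function.Bundles using (_⤖_; Bijection; mk↔ₛ′)
open import Function.Properties.Inverse using (↔⇒⤖)
open import Relation.Binary.PropositionalEquality

private
  variable
    m n j : ℕ

∣∁p∣+∣p∣≡n : (p : Subset n) → ∣ ∁ p ∣ + ∣ p ∣ ≡ n
∣∁p∣+∣p∣≡n []          = refl
∣∁p∣+∣p∣≡n (true ∷ p)  = trans (+-suc ∣ ∁ p ∣ ∣ p ∣) (cong suc (∣∁p∣+∣p∣≡n p))
∣∁p∣+∣p∣≡n (false ∷ p) = cong suc (∣∁p∣+∣p∣≡n p)

∣p++q∣≡∣p∣+∣q∣ : (p : Subset m) (q : Subset n) → ∣ p ++ q ∣ ≡ ∣ p ∣ + ∣ q ∣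
∣p++q∣≡∣p∣+∣q∣ []          q = refl
∣p++q∣≡∣p∣+∣q∣ (true ∷ p)  q = cong suc (∣p++q∣≡∣p∣+∣q∣ p q)
∣p++q∣≡∣p∣+∣q∣ (false ∷ p) q = ∣p++q∣≡∣p∣+∣q∣ p q

∣take∣≤∣p∣ : ∀ m (p : Subset (m + n)) → ∣ take m p ∣ ≤ ∣ p ∣
∣take∣≤∣p∣ m p = subst (∣ take m p ∣ ≤_) ∣take∣+∣drop∣≡∣p∣ (m≤m+n _ _)
  where
  ∣take∣+∣drop∣≡∣p∣ : ∣ take m p ∣ + ∣ drop m p ∣ ≡ ∣ p ∣
  ∣take∣+∣drop∣≡∣p∣ = trans (sym (∣p++q∣≡∣p∣+∣q∣ (take m p) (drop m p))) (cong ∣_∣ (take++drop≡id m p))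

take-drop-++ : ∀ {A : Set} (xs : Vec A m) (ys : Vec A n) → take m (xs ++ ys) ≡ xs × drop m (xs ++ ys) ≡ ys
take-drop-++ {m} xs ys = ++-injective (take m (xs ++ ys)) xs (take++drop≡id m (xs ++ ys))

cast-natural : ∀ {A B : Set} (f : ∀ {n} → Vec A n → B) (eq : m ≡ n) (xs : Vec A m) → f (cast eq xs) ≡ f xs
cast-natural f refl xs = cong f (cast-is-id refl xs)

replicate-suc-++ : ∀ {A : Set} d (x : A) (xs : List A) → List.replicate (suc d) x List.++ xs ≡ List.replicate d x List.++ (x List.∷ xs)
replicate-suc-++ zero    x xs = refl
replicate-suc-++ (suc d) x xs = cong (x List.∷_) (replicate-suc-++ d x xs)

encode : (μ : Multiset m) → Vec Bool (msCard μ)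
encode []          = []
encode (zero ∷ μ)  = encode μ
encode (suc a ∷ μ) = false ∷ (replicate a true ++ encode μ)

-- decode S w hands the blocks of w to the elements of S in order; the letter opening
-- each block is skipped unread (it is a bar in every word that encode produces).
mutual
  decode : Subset m → Vec Bool n → Multiset m
  decode []          w       = []
  decode (false ∷ S) w       = 0 ∷ decode S w
  decode (true ∷ S)  []      = readStars S [] 1
  decode (true ∷ S)  (_ ∷ w) = readStars S w 1

  readStars : Subset m → Vec Bool n → ℕ → Multiset (suc m)
  readStars S []          d = d ∷ decode S []
  readStars S (true ∷ w)  d = readStars S w (suc d)
  readStars S (false ∷ w) d = d ∷ decode S (false ∷ w)

mutual
  support-decode : (S : Subset m) (w : Vec Bool n) → support (decode S w) ≡ S
  support-decode []          w       = refl
  support-decode (false ∷ S) w       = cong (false ∷_) (support-decode S w)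
  support-decode (true ∷ S)  []      = support-readStars S [] 0
  support-decode (true ∷ S)  (_ ∷ w) = support-readStars S w 0

  support-readStars : (S : Subset m) (w : Vec Bool n) (d : ℕ) → support (readStars S w (suc d)) ≡ true ∷ S
  support-readStars S []          d = cong (true ∷_) (support-decode S [])
  support-readStars S (true ∷ w)  d = support-readStars S w (suc d)
  support-readStars S (false ∷ w) d = cong (true ∷_) (support-decode S (false ∷ w))

readStars-replicate : (S : Subset m) (a : ℕ) (w : Vec Bool n) (d : ℕ) →
                      readStars S (replicate a true ++ w) d ≡ readStars S w (a + d)
readStars-replicate S zero    w d = refl
readStars-replicate S (suc a) w d =
  trans (readStars-replicate S a w (suc d)) (cong (readStars S w) (+-suc a d))

readStars-encode : (S : Subset m) (μ : Multiset n) (d : ℕ) → readStars S (encode μ) d ≡ d ∷ decode S (encode μ)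
readStars-encode S []          d = refl
readStars-encode S (zero ∷ μ)  d = readStars-encode S μ d
readStars-encode S (suc a ∷ μ) d = refl

decode-encode : (μ : Multiset m) → decode (support μ) (encode μ) ≡ μ
decode-encode []          = refl
decode-encode (zero ∷ μ)  = cong (0 ∷_) (decode-encode μ)
decode-encode (suc a ∷ μ) = begin
  readStars (support μ) (replicate a true ++ encode μ) 1  ≡⟨ readStars-replicate (support μ) a (encode μ) 1 ⟩
  readStars (support μ) (encode μ) (a + 1)                ≡⟨ readStars-encode (support μ) μ (a + 1) ⟩
  a + 1 ∷ decode (support μ) (encode μ)                   ≡⟨ cong₂ _∷_ (+-comm a 1) (decode-encode μ) ⟩
  suc a ∷ μ                                               ∎
  where open ≡-Reasoning

toList-encode-decode-∅ : (S : Subset m) (w : Vec Bool n) → ∣ S ∣ ≡ 0 → toList (encode (decode S w)) ≡ List.[]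
toList-encode-decode-∅ []          w _  = refl
toList-encode-decode-∅ (false ∷ S) w eq = toList-encode-decode-∅ S w eq

toList-bar-stars-++ : ∀ d (xs : Vec Bool n) →
                      toList (false ∷ (replicate d true ++ xs)) ≡ false List.∷ (List.replicate d true List.++ toList xs)
toList-bar-stars-++ d xs =
  cong (false List.∷_) (trans (toList-++ (replicate d true) xs) (cong (List._++ toList xs) (toList-replicate d true)))

-- Compared as lists: the two vectors have lengths msCard (decode …) and suc n, which
-- agree only propositionally.
mutual
  toList-encode-decode : (S : Subset m) (w : Vec Bool n) → ∣ S ∣ ≡ ∣ ∁ (false ∷ w) ∣ →
                         toList (encode (decode S (false ∷ w))) ≡ false List.∷ toList w
  toList-encode-decode (false ∷ S) w eq = toList-encode-decode S w eq
  toList-encode-decode (true ∷ S)  w eq = toList-encode-readStars S w 0 (suc-injective eq)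

  toList-encode-readStars : (S : Subset m) (w : Vec Bool n) (d : ℕ) → ∣ S ∣ ≡ ∣ ∁ w ∣ →
    toList (encode (readStars S w (suc d))) ≡ false List.∷ (List.replicate d true List.++ toList w)
  toList-encode-readStars S [] d eq = begin
    toList (false ∷ (replicate d true ++ encode (decode S [])))
      ≡⟨ toList-bar-stars-++ d (encode (decode S [])) ⟩
    false List.∷ (List.replicate d true List.++ toList (encode (decode S [])))
      ≡⟨ cong (λ xs → false List.∷ (List.replicate d true List.++ xs)) (toList-encode-decode-∅ S [] eq) ⟩
    false List.∷ (List.replicate d true List.++ List.[])
      ∎
    where open ≡-Reasoning
  toList-encode-readStars S (true ∷ w) d eq =
    trans (toList-encode-readStars S w (suc d) eq)
          (cong (false List.∷_) (replicate-suc-++ d true (toList w)))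
  toList-encode-readStars S (false ∷ w) d eq = begin
    toList (false ∷ (replicate d true ++ encode (decode S (false ∷ w))))
      ≡⟨ toList-bar-stars-++ d (encode (decode S (false ∷ w))) ⟩
    false List.∷ (List.replicate d true List.++ toList (encode (decode S (false ∷ w))))
      ≡⟨ cong (λ xs → false List.∷ (List.replicate d true List.++ xs)) (toList-encode-decode S w eq) ⟩
    false List.∷ (List.replicate d true List.++ (false List.∷ toList w))
      ∎
    where open ≡-Reasoning

∣∁encode∣≡∣support∣ : (μ : Multiset m) → ∣ ∁ (encode μ) ∣ ≡ ∣ support μ ∣
∣∁encode∣≡∣support∣ []          = refl
∣∁encode∣≡∣support∣ (zero ∷ μ)  = ∣∁encode∣≡∣support∣ μ
∣∁encode∣≡∣support∣ (suc a ∷ μ) = cong suc (∣∁stars++∣ a)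
  where
  ∣∁stars++∣ : ∀ a → ∣ ∁ (replicate a true ++ encode μ) ∣ ≡ ∣ support μ ∣
  ∣∁stars++∣ zero    = ∣∁encode∣≡∣support∣ μ
  ∣∁stars++∣ (suc a) = ∣∁stars++∣ a

encode-startsWithBar : (μ : Multiset m) (eq : msCard μ ≡ suc n) →
                       cast eq (encode μ) ≡ false ∷ tail (cast eq (encode μ))
encode-startsWithBar (zero ∷ μ)  eq = encode-startsWithBar μ eq
encode-startsWithBar (suc a ∷ μ) eq = refl

msCard-decode : (S : Subset m) (w : Vec Bool n) → ∣ S ∣ ≡ ∣ ∁ (false ∷ w) ∣ →
                msCard (decode S (false ∷ w)) ≡ suc n
msCard-decode {n = n} S w eq = begin
  msCard (decode S (false ∷ w))                           ≡⟨ length-toList (encode (decode S (false ∷ w))) ⟨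
  List.length (toList (encode (decode S (false ∷ w))))    ≡⟨ cong List.length (toList-encode-decode S w eq) ⟩
  suc (List.length (toList w))                            ≡⟨ cong suc (length-toList w) ⟩
  suc n                                                   ∎
  where open ≡-Reasoning

msCard-∩ₘ-fullSet : (μ ν : Multiset m) → msCard ((μ ∩ₘ ν) ∩ₘ fullSetₘ m) ≡ ∣ support μ ∩ support ν ∣
msCard-∩ₘ-fullSet []          []          = refl
msCard-∩ₘ-fullSet (zero ∷ μ)  (_ ∷ ν)     = msCard-∩ₘ-fullSet μ ν
msCard-∩ₘ-fullSet (suc a ∷ μ) (zero ∷ ν)  = msCard-∩ₘ-fullSet μ ν
msCard-∩ₘ-fullSet (suc a ∷ μ) (suc b ∷ ν) = cong₂ (λ x y → suc (x + y)) (⊓-zeroʳ (a ⊓ b)) (msCard-∩ₘ-fullSet μ ν)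

≡-by-proj₁ : ∀ {A : Set} {f : A → ℕ} {k} {x y : Σ A (λ a → f a ≡ k)} → proj₁ x ≡ proj₁ y → x ≡ y
≡-by-proj₁ eq = Σ-≡,≡→≡ (eq , ≡-irrelevant _ _)

∣take∣≡∣∁[false∷drop]∣ : ∀ m (A : Subset (m + j)) → ∣ A ∣ ≡ suc j → ∣ take m A ∣ ≡ ∣ ∁ (false ∷ drop m A) ∣
∣take∣≡∣∁[false∷drop]∣ {j} m A ∣A∣≡k = +-cancelʳ-≡ ∣ w ∣ ∣ S ∣ (suc ∣ ∁ w ∣) (begin
  ∣ S ∣ + ∣ w ∣        ≡⟨ ∣p++q∣≡∣p∣+∣q∣ S w ⟨
  ∣ S ++ w ∣           ≡⟨ cong ∣_∣ (take++drop≡id m A) ⟩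
  ∣ A ∣                ≡⟨ ∣A∣≡k ⟩
  suc j                ≡⟨ cong suc (∣∁p∣+∣p∣≡n w) ⟨
  suc ∣ ∁ w ∣ + ∣ w ∣  ∎)
  where
  open ≡-Reasoning
  S = take m A
  w = drop m A

toMultiset : ∀ m → KSubset (m + j) (suc j) → KMultiset m (suc j)
toMultiset m (A , ∣A∣≡k) =
  decode (take m A) (false ∷ drop m A) ,
  msCard-decode (take m A) (drop m A) (∣take∣≡∣∁[false∷drop]∣ m A ∣A∣≡k)

fromMultiset : ∀ m → KMultiset m (suc j) → KSubset (m + j) (suc j)
fromMultiset {j} m (μ , eq) = support μ ++ word , ∣support++word∣≡k
  where
  open ≡-Reasoning
  word = tail (cast eq (encode μ))
  ∣support++word∣≡k : ∣ support μ ++ word ∣ ≡ suc j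
  ∣support++word∣≡k = begin
    ∣ support μ ++ word ∣               ≡⟨ ∣p++q∣≡∣p∣+∣q∣ (support μ) word ⟩
    ∣ support μ ∣ + ∣ word ∣            ≡⟨ cong (_+ ∣ word ∣) (∣∁encode∣≡∣support∣ μ) ⟨
    ∣ ∁ (encode μ) ∣ + ∣ false ∷ word ∣ ≡⟨ cong (λ w → ∣ ∁ (encode μ) ∣ + ∣ w ∣) (encode-startsWithBar μ eq) ⟨
    ∣ ∁ (encode μ) ∣ + ∣ cast eq (encode μ) ∣ ≡⟨ cong (∣ ∁ (encode μ) ∣ +_) (cast-natural ∣_∣ eq (encode μ)) ⟩
    ∣ ∁ (encode μ) ∣ + ∣ encode μ ∣      ≡⟨ ∣∁p∣+∣p∣≡n (encode μ) ⟩
    msCard μ                             ≡⟨ eq ⟩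
    suc j                                ∎

toMultiset-fromMultiset : ∀ m (x : KMultiset m (suc j)) → toMultiset m (fromMultiset m x) ≡ x
toMultiset-fromMultiset m (μ , eq) = ≡-by-proj₁ (begin
  decode (take m (support μ ++ word)) (false ∷ drop m (support μ ++ word))
    ≡⟨ cong₂ (λ S w → decode S (false ∷ w)) (proj₁ take-drop) (proj₂ take-drop) ⟩
  decode (support μ) (false ∷ word)
    ≡⟨ cong (decode (support μ)) (encode-startsWithBar μ eq) ⟨
  decode (support μ) (cast eq (encode μ))
    ≡⟨ cast-natural (decode (support μ)) eq (encode μ) ⟩
  decode (support μ) (encode μ)
    ≡⟨ decode-encode μ ⟩
  μ ∎)
  where
  open ≡-Reasoning
  word = tail (cast eq (encode μ))
  take-drop = take-drop-++ (support μ) word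

fromMultiset-toMultiset : ∀ m (x : KSubset (m + j) (suc j)) → fromMultiset m (toMultiset m x) ≡ x
fromMultiset-toMultiset m (A , ∣A∣≡k) = ≡-by-proj₁ (begin
  support μ ++ tail (cast eq (encode μ))  ≡⟨ cong₂ _++_ (support-decode S (false ∷ w)) (cong tail encode-μ) ⟩
  S ++ w                                  ≡⟨ take++drop≡id m A ⟩
  A                                       ∎)
  where
  open ≡-Reasoning
  S = take m A
  w = drop m A
  bars = ∣take∣≡∣∁[false∷drop]∣ m A ∣A∣≡k
  μ = decode S (false ∷ w)
  eq = msCard-decode S w bars
  encode-μ : cast eq (encode μ) ≡ false ∷ w
  encode-μ = toList-injective eq (encode μ) (false ∷ w) (toList-encode-decode S w bars)

toMultiset-preservesAdjacency : ∀ m t (A B : KSubset (m + j) (suc j)) →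
  KAdj (m + j) (suc j) t A B → MAdj m (suc j) t (toMultiset m A) (toMultiset m B)
toMultiset-preservesAdjacency m t (A , _) (B , _) ∣A∩B∣<t = begin-strict
  msCard ((μ ∩ₘ ν) ∩ₘ fullSetₘ m)  ≡⟨ msCard-∩ₘ-fullSet μ ν ⟩
  ∣ support μ ∩ support ν ∣        ≡⟨ cong₂ (λ S T → ∣ S ∩ T ∣) (support-decode (take m A) _) (support-decode (take m B) _) ⟩
  ∣ take m A ∩ take m B ∣          ≡⟨ cong ∣_∣ (take-zipWith {m = m} _ A B) ⟨
  ∣ take m (A ∩ B) ∣               ≤⟨ ∣take∣≤∣p∣ m (A ∩ B) ⟩
  ∣ A ∩ B ∣                        <⟨ ∣A∩B∣<t ⟩
  t                                ∎
  where
  open Data.Nat.Properties.≤-Reasoning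
  μ = decode (take m A) (false ∷ drop m A)
  ν = decode (take m B) (false ∷ drop m B)

proposition4p2 : (m k t : ℕ) → 1 ≤ m → 1 ≤ k → 1 ≤ t →
    Σ (KSubset (m + (k ∸ 1)) k ⤖ KMultiset m k) λ f →
      ((A : KSubset (m + (k ∸ 1)) k) →
          support (proj₁ (Bijection.to f A)) ≡ restrict m (proj₁ A))
      × ((A B : KSubset (m + (k ∸ 1)) k) →
          KAdj (m + (k ∸ 1)) k t A B →
          MAdj m k t (Bijection.to f A) (Bijection.to f B))
proposition4p2 m zero    t _ () _
proposition4p2 m (suc j) t _ _  _ =
  ↔⇒⤖ (mk↔ₛ′ (toMultiset m) (fromMultiset m) (toMultiset-fromMultiset m) (fromMultiset-toMultiset m)) ,
  (λ (A , _) → support-decode (take m A) _) ,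
  toMultiset-preservesAdjacency m t
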